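{- Let $(S_0,F_0),\ldots,(S_n,F_n)$ be an evolution of $t$-societies (as defined in the context) with respect to the chains $C_1,C_2,\ldots$. Let $Y_1,\ldots,Y_q$ be groups and let $[a_1,b_1],\ldots,[a_q,b_q]$ be pairwise disjoint intervals with integer endpoints $0\le a_j\le b_j\le n$ such that, for each $j$, $b_j$ is the largest integer with $Y_j\in S_{b_j}$. Then $\sum_{j=1}^{q} N^{\alpha}_{a_j,b_j}(Y_j)\le \varepsilon n$, where $\varepsilon=1/(2t)$.
   Context: Let $P$ be a finite poset. A First-Fit chain partition of $P$ is an ordered partition $C_1,\ldots,C_m$ of $P$ into non-empty chains such that whenever $i<j$ and $x\in C_j$, some element of $C_i$ is incomparable to $x$. Fix such a partition and set $C_j=\emptyset$ for $j>m$. A group is a subset of $P$. For a positive integer $t$, a $t$-society is a pair $(S,F)$ where $S$ is a set of groups and $F: S\times\{1,\ldots,t\}\to S\cup\{\star\}$ is a function; $X$ lists $Y$ as a friend in slot $k$ if $F(X,k)=Y$. Let $\varepsilon=1/(2t)$. An evolution is a sequence $(S_0,F_0),\ldots,(S_n,F_n)$ of $t$-societies with $(S_0,F_0)$ arbitrary, $S_n=\emptyset$, and for each $1\le j\le n$: $S_j$ consists exactly of those $X\in S_{j-1}$ satisfying one of the following, and the type of the transition of $X$ from $S_{j-1}$ to $S_j$ is the first rule that applies: ($\alpha$) $X\cap C_j\neq\emptyset$; ($\beta$) otherwise, some friend $F_{j-1}(X,k)\neq\star$ of $X$ in $(S_{j-1},F_{j-1})$ satisfies $F_{j-1}(X,k)\cap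 C_j\neq\emptyset$; ($\gamma$) otherwise, there is an integer $i$ with $0\le i\le j-1$ and $N^{\alpha}_{i,j-1}(X)>\varepsilon(j-i)$. Here, for $i\le j$ and $a\in\{\alpha,\beta,\gamma\}$, $N^a_{i,j}(X)$ is the number of indices $l$ with $i<l\le j$ such that $X\in S_l$ and $X$ makes a transition of type $a$ from $S_{l-1}$ to $S_l$. Friendships are permanent: if $F_{j-1}(X,k)=Y$ and $X,Y\in S_j$, then $F_j(X,k)=Y$; otherwise $F_j(X,k)$ may be any element of $S_j\cup\{\star\}$. -}

module Defs where

open import Data.Nat using (ℕ; zero; suc; _+_; _*_; _∸_; _≤_; _<_; _<?_; _≤?_)
open import Data.Bool using (Bool; true; false; _∧_; _∨_; if_then_else_)
open import Data.Maybe using (Maybe; just; nothing)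
open import Data.Fin using (Fin; fromℕ<) renaming (_<_ to _<ᶠ_)
open import Data.Fin.Subset using (Subset; _∈_; _∩_; ⊥; Nonempty)
open import Data.Fin.Subset.Properties using (nonempty?)
open import Data.Product using (Σ; _×_; ∃)
open import Data.Sum using (_⊎_)
open import Relation.Nullary using (¬_; yes; no)
open import Relation.Nullary.Decidable using (⌊_⌋)
open import Relation.Binary.PropositionalEquality using (_≡_)
open import Function.Bundles using (_⇔_)

-- The poset P is Fin p with an order relation _≼_ (assumed a partial order
-- in the statement).  A group is a subset of P.
Group : ℕ → Set
Group p = Subset p

IsChain : ∀ {p} → (Fin p → Fin p → Set) → Subset p → Set
IsChain _≼_ A = ∀ x y → x ∈ A → y ∈ A → (x ≼ y) ⊎ (y ≼ x)

-- An ordered chain partition C_1,...,C_m (C_{i+1} = Cs i) which is First-Fit.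
record IsFirstFitChainPartition {p m : ℕ} (_≼_ : Fin p → Fin p → Set)
                                (Cs : Fin m → Subset p) : Set where
  field
    nonempty : ∀ i → Nonempty (Cs i)
    chains   : ∀ i → IsChain _≼_ (Cs i)
    covers   : ∀ x → ∃ λ i → x ∈ Cs i
    disjoint : ∀ i i' x → x ∈ Cs i → x ∈ Cs i' → i ≡ i'
    firstFit : ∀ i j x → i <ᶠ j → x ∈ Cs j →
               ∃ λ y → y ∈ Cs i × ¬ (y ≼ x) × ¬ (x ≼ y)

-- C_j for j ≥ 1 (1-indexed); C_j = ∅ for j > m (and C_0 = ∅, never used).
chainAt : ∀ {p m} → (Fin m → Subset p) → ℕ → Subset p
chainAt {m = m} Cs zero = ⊥
chainAt {m = m} Cs (suc j) with j <? m
... | yes j<m = Cs (fromℕ< j<m)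
... | no  _   = ⊥

meets : ∀ {p} → Subset p → Subset p → Bool
meets X C = ⌊ nonempty? (X ∩ C) ⌋

-- A sequence of t-societies: S j is the set of groups of the j-th society
-- (as a characteristic function), F j X k is the friend of X in slot k
-- (nothing = ⋆); slots {1..t} are Fin t.
Societies : ℕ → Set
Societies p = ℕ → Group p → Bool

Friends : ℕ → ℕ → Set
Friends p t = ℕ → Group p → Fin t → Maybe (Group p)

-- [X ∈ S_l and X makes a transition of type α from S_{l-1} to S_l]   (l ≥ 1)
isAlpha : ∀ {p} → Societies p → (ℕ → Subset p) → ℕ → Group p → Bool
isAlpha S C l X = S l X ∧ meets X (C l)

Nα : ∀ {p} → Societies p → (ℕ → Subset p) → ℕ → ℕ → Group p → ℕ
Nα S C i zero X = 0
Nα S C i (suc j) X with i ≤? j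
... | yes _ = Nα S C i j X + (if isAlpha S C (suc j) X then 1 else 0)
... | no  _ = 0

AlphaRule : ∀ {p} → (ℕ → Subset p) → ℕ → Group p → Set
AlphaRule C j X = meets X (C j) ≡ true

-- rule (β): some friend (in society j-1) meets C_j; here j = suc j'
BetaRule : ∀ {p t} → Friends p t → (ℕ → Subset p) → ℕ → Group p → Set
BetaRule F C j' X = ∃ λ k → ∃ λ Y → F j' X k ≡ just Y × meets Y (C (suc j')) ≡ true

-- rule (γ): ∃ i, 0 ≤ i ≤ j-1, N^α_{i,j-1}(X) > ε (j - i), ε = 1/(2t),
-- i.e. (j - i) < 2t · N^α_{i,j-1}(X); here j = suc j'
GammaRule : ∀ {p} → ℕ → Societies p → (ℕ → Subset p) → ℕ → Group p → Set
GammaRule t S C j' X =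
  ∃ λ i → i ≤ j' × (suc j' ∸ i) < 2 * t * Nα S C i j' X

record IsEvolution {p t : ℕ} (n : ℕ) (C : ℕ → Subset p)
                   (S : Societies p) (F : Friends p t) : Set where
  field
    society   : ∀ j X k Y → j ≤ n → S j X ≡ true → F j X k ≡ just Y → S j Y ≡ true
    final     : ∀ X → S n X ≡ false
    step      : ∀ j' X → suc j' ≤ n →
                (S (suc j') X ≡ true ⇔
                  (S j' X ≡ true × (AlphaRule C (suc j') X ⊎ BetaRule F C j' X ⊎ GammaRule t S C j' X)))
    permanent : ∀ j' X k Y → suc j' ≤ n → F j' X k ≡ just Y →
                S (suc j') X ≡ true → S (suc j') Y ≡ true → F (suc j') X k ≡ just Y

-- A group Y_j leaves the society at step b_j + 1, so rule (γ) fails there for i = a_j: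
-- 2t · N^α_{a_j,b_j}(Y_j) ≤ b_j + 1 − a_j, the length of [a_j, b_j].  Since S_n = ∅,
-- every b_j < n, so the disjoint intervals [a_j, b_j] pack into [0, n) and their
-- lengths sum to at most n.
module Submission where

open import Defs
open import Data.Nat using (ℕ; _*_; _≤_; _<_)
open import Data.Bool using (true; false)
open import Data.Fin using (Fin)
open import Data.Fin.Subset using (Subset)
open import Data.Vec using (sum; tabulate)
open import Data.Sum using (_⊎_)
open import Relation.Binary.PropositionalEquality using (_≡_; _≢_)
open import Relation.Binary.Structures using (IsPartialOrder)

open import Data.Nat using (zero; suc; _+_; _∸_; _<?_; z≤n)
open import Data.Nat.Properties hiding (suc-injective)
open import Data.Nat.Solver using (module +-*-Solver)
open import Data.Fin using (zero; suc)
open import Data.Fin.Properties using (suc-injective)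
open import Data.Sum using (inj₁; inj₂)
open import Data.Product using (_×_; _,_)
open import Data.Empty using (⊥-elim)
open import Data.Vec.Functional using (Vector)
open import Relation.Nullary using (¬_; Dec; yes; no)
open import Relation.Binary.PropositionalEquality
  using (refl; sym; trans; cong; subst; module ≡-Reasoning)
open import Function.Bundles using (Equivalence)
open import Algebra.Properties.Semiring.Sum +-*-semiring
  using (∑-distrib-+; *-distribˡ-sum; sum-cong-≗) renaming (sum to ∑)

sum-tabulate : ∀ {q} (f : Vector ℕ q) → sum (tabulate f) ≡ ∑ f
sum-tabulate {zero}  f = refl
sum-tabulate {suc q} f = cong (f zero +_) (sum-tabulate (λ j → f (suc j)))

keepIf keepUnless : ∀ {P : Set} → Dec P → ℕ → ℕ
keepIf     (yes _) x = x
keepIf     (no  _) x = 0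
keepUnless (yes _) x = 0
keepUnless (no  _) x = x

keepIf-+-keepUnless : ∀ {P : Set} (d : Dec P) x → keepIf d x + keepUnless d x ≡ x
keepIf-+-keepUnless (yes _) x = +-identityʳ x
keepIf-+-keepUnless (no  _) x = refl

PairwiseDisjoint : ∀ {q} (a b : Vector ℕ q) → Set
PairwiseDisjoint a b = ∀ j j' → j ≢ j' → (b j < a j') ⊎ (b j' < a j)

PairwiseDisjoint-tail : ∀ {q} {a b : Vector ℕ (suc q)} → PairwiseDisjoint a b →
                        PairwiseDisjoint (λ j → a (suc j)) (λ j → b (suc j))
PairwiseDisjoint-tail dis j j' j≢j' = dis (suc j) (suc j') (λ e → j≢j' (suc-injective e))

-- The zero-weight alternative is what lets a family be restricted to a sub-range.
WeightFitsIn : (L R w a b : ℕ) → Set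
WeightFitsIn L R w a b = w ≡ 0 ⊎ (L ≤ a × b < R × w + a ≤ suc b)

-- Interval 0 cuts [L, R) into [L, a₀) and [b₀ + 1, R); every other interval lies in one of them.
∑-weights-disjoint-intervals : ∀ {q} (w a b : Vector ℕ q) {L R} → L ≤ R →
  PairwiseDisjoint a b → (∀ j → WeightFitsIn L R (w j) (a j) (b j)) → ∑ w + L ≤ R
∑-weights-disjoint-intervals {zero}  w a b L≤R dis fits = L≤R
∑-weights-disjoint-intervals {suc q} w a b {L} {R} L≤R dis fits with fits zero
... | inj₁ w₀≡0 rewrite w₀≡0 =
  ∑-weights-disjoint-intervals w′ a′ b′ L≤R (PairwiseDisjoint-tail dis) (λ j → fits (suc j))
  where
  w′ a′ b′ : Vector ℕ q
  w′ j = w (suc j)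
  a′ j = a (suc j)
  b′ j = b (suc j)
... | inj₂ (L≤a₀ , b₀<R , w₀+a₀≤1+b₀) = begin
  w zero + ∑ w′ + L                 ≡⟨ cong (λ s → w zero + s + L) ∑w′-split ⟩
  w zero + (∑ left + ∑ right) + L   ≡⟨ shuffle (w zero) (∑ left) (∑ right) L ⟩
  ∑ right + (w zero + (∑ left + L)) ≤⟨ +-monoʳ-≤ (∑ right) (+-monoʳ-≤ (w zero) left-packs) ⟩
  ∑ right + (w zero + a zero)       ≤⟨ +-monoʳ-≤ (∑ right) w₀+a₀≤1+b₀ ⟩
  ∑ right + suc (b zero)            ≤⟨ right-packs ⟩
  R                                 ∎
  where
  open ≤-Reasoning
  w′ a′ b′ left right : Vector ℕ q
  w′ j = w (suc j)
  a′ j = a (suc j)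
  b′ j = b (suc j)
  left  j = keepIf     (b′ j <? a zero) (w′ j)
  right j = keepUnless (b′ j <? a zero) (w′ j)

  ∑w′-split : ∑ w′ ≡ ∑ left + ∑ right
  ∑w′-split = trans (sum-cong-≗ (λ j → sym (keepIf-+-keepUnless (b′ j <? a zero) (w′ j))))
                    (∑-distrib-+ left right)

  left-fits : ∀ j → WeightFitsIn L (a zero) (left j) (a′ j) (b′ j)
  left-fits j with b′ j <? a zero | fits (suc j)
  ... | no  _     | _                    = inj₁ refl
  ... | yes _     | inj₁ w≡0             = inj₁ w≡0
  ... | yes b<a₀  | inj₂ (L≤a , _ , len) = inj₂ (L≤a , b<a₀ , len)

  right-fits : ∀ j → WeightFitsIn (suc (b zero)) R (right j) (a′ j) (b′ j)
  right-fits j with b′ j <? a zero | fits (suc j)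
  ... | yes _    | _                    = inj₁ refl
  ... | no  _    | inj₁ w≡0             = inj₁ w≡0
  ... | no  b≮a₀ | inj₂ (_ , b<R , len) with dis zero (suc j) (λ ())
  ...   | inj₁ b₀<a = inj₂ (b₀<a , b<R , len)
  ...   | inj₂ b<a₀ = ⊥-elim (b≮a₀ b<a₀)

  left-packs : ∑ left + L ≤ a zero
  left-packs = ∑-weights-disjoint-intervals left a′ b′ L≤a₀ (PairwiseDisjoint-tail dis) left-fits

  right-packs : ∑ right + suc (b zero) ≤ R
  right-packs = ∑-weights-disjoint-intervals right a′ b′ b₀<R (PairwiseDisjoint-tail dis) right-fits

  shuffle : ∀ x y z u → x + (y + z) + u ≡ z + (x + (y + u))
  shuffle = solve 4 (λ x y z u → x :+ (y :+ z) :+ u := z :+ (x :+ (y :+ u))) refl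
    where open +-*-Solver

module _ {p t n} {C : ℕ → Subset p} {S : Societies p} {F : Friends p t}
         (ev : IsEvolution n C S F) where

  open IsEvolution ev

  member⇒<final : ∀ {j X} → S j X ≡ true → j ≤ n → j < n
  member⇒<final {j} {X} X∈Sⱼ j≤n with m≤n⇒m<n∨m≡n j≤n
  ... | inj₁ j<n = j<n
  ... | inj₂ refl with trans (sym X∈Sⱼ) (final X)
  ...   | ()

  -- Otherwise rule (γ) would keep X in the society.
  leaves⇒Nα-bounded : ∀ {j' X i} → suc j' ≤ n → S j' X ≡ true → S (suc j') X ≡ false →
                      i ≤ j' → 2 * t * Nα S C i j' X ≤ suc j' ∸ i
  leaves⇒Nα-bounded {j'} {X} {i} j'<n X∈Sⱼ X∉Sⱼ₊₁ i≤j' = ≮⇒≥ ¬γ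
    where
    ¬γ : ¬ (suc j' ∸ i < 2 * t * Nα S C i j' X)
    ¬γ γ with trans (sym (Equivalence.from (step j' X j'<n) (X∈Sⱼ , inj₂ (inj₂ (i , i≤j' , γ)))))
                    X∉Sⱼ₊₁
    ... | ()

lemma1 : (p : ℕ) (_≼_ : Fin p → Fin p → Set) → IsPartialOrder _≡_ _≼_ →
    (m : ℕ) (Cs : Fin m → Subset p) → IsFirstFitChainPartition _≼_ Cs →
    (t : ℕ) → 1 ≤ t → (n : ℕ) →
    (S : Societies p) (F : Friends p t) → IsEvolution n (chainAt Cs) S F →
    (q : ℕ) (Y : Fin q → Group p) (a b : Fin q → ℕ) →
    (∀ j → a j ≤ b j) → (∀ j → b j ≤ n) →
    (∀ j j' → j ≢ j' → (b j < a j') ⊎ (b j' < a j)) →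
    (∀ j → S (b j) (Y j) ≡ true) →
    (∀ j l → b j < l → l ≤ n → S l (Y j) ≡ false) →
    2 * t * sum (tabulate (λ j → Nα S (chainAt Cs) (a j) (b j) (Y j))) ≤ n
-- Only the evolution rules matter: the poset, the First-Fit property and 1 ≤ t are unused.
lemma1 _ _ _ _ Cs _ t _ n S F ev q Y a b a≤b b≤n dis alive dead =
  subst (_≤ n) total (∑-weights-disjoint-intervals weight a b z≤n dis fits)
  where
  N weight : Vector ℕ q
  N j = Nα S (chainAt Cs) (a j) (b j) (Y j)
  weight j = 2 * t * N j

  b<n : ∀ j → b j < n
  b<n j = member⇒<final ev (alive j) (b≤n j)

  fits : ∀ j → WeightFitsIn 0 n (weight j) (a j) (b j)
  fits j = inj₂ (z≤n , b<n j , (begin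
    weight j + a j         ≤⟨ +-monoˡ-≤ (a j) bound ⟩
    suc (b j) ∸ a j + a j  ≡⟨ m∸n+n≡m (m≤n⇒m≤1+n (a≤b j)) ⟩
    suc (b j)              ∎))
    where
    open ≤-Reasoning
    bound = leaves⇒Nα-bounded ev (b<n j) (alive j) (dead j (suc (b j)) ≤-refl (b<n j)) (a≤b j)

  total : ∑ weight + 0 ≡ 2 * t * sum (tabulate N)
  total = begin
    ∑ weight + 0             ≡⟨ +-identityʳ _ ⟩
    ∑ weight                 ≡⟨ sym (*-distribˡ-sum (2 * t) N) ⟩
    2 * t * ∑ N              ≡⟨ cong (2 * t *_) (sym (sum-tabulate N)) ⟩
    2 * t * sum (tabulate N) ∎
    where open ≡-Reasoning
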